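{- Let $n\ge 1$ and $m\ge 1$ be integers and consider the $n$-dimensional $m$-Catalan arrangement with its Pak–Stanley labeling. Let $i\in[n-1]$, let $\tau=(i,i+1)\in\mathfrak S_n$ be the adjacent transposition, and let $\pi,\rho\in\mathfrak S_n$ with $\rho=\tau\circ\pi$. Let $R$ be a region of the arrangement contained in the fundamental chamber, and let $\mathbf b=(b_1,\dots,b_n)$ and $\mathbf c=(c_1,\dots,c_n)$ be the Pak–Stanley labels of the regions $\pi(R)$ and $\rho(R)$ respectively. Then $$\mathbf c=\mathbf b\circ\tau+\begin{cases} e_i, & \text{if } b_i\le b_{i+1},\\ -e_{i+1}, & \text{otherwise,}\end{cases}$$ where $(\mathbf b\circ\tau)_k=b_{\tau(k)}$.
   Context: $\mathbb N=\{1,2,3,\dots\}$, $[k,l]=\{k,k+1,\dots,l\}$, $[n]=[1,n]$, $e_j$ is the $j$-th standard basis vector of $\mathbb R^n$ and $\mathbf 1=(1,\dots,1)$. The $n$-dimensional $m$-Catalan arrangement consists of the hyperplanes $H_{i,j,a}=\{x\in\mathbb R^n: x_i-x_j=a\}$ for $1\le i<j\le n$ and integers $a\in[-m,m]$; its regions are the connected components of the complement of the union of these hyperplanes. Let $R_0$ be the region containing the points with $x_1>x_2>\dots>x_n$ and $x_1-x_n<1$. The Pak–Stanley label of a region $R$ is $\lambda(R)=\mathbf 1+\sum_H e_{c(H)}$, the sum over all hyperplanes $H$ of the arrangement separating $R$ from $R_0$, where for $H=H_{i,j,a}$ ($i<j$) one sets $c(H)=j$ if $a>0$ and $c(H)=i$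 if $a\le 0$. The fundamental chamber is $\{x: x_1>x_2>\dots>x_n\}$. A permutation $\pi\in\mathfrak S_n$ acts on $\mathbb R^n$ by $\pi(x_1,\dots,x_n)=(x_{\pi^{ -1}(1)},\dots,x_{\pi^{ -1}(n)})$; this action maps regions of the arrangement to regions. -}

module Defs where

open import Data.Nat as ℕ using (ℕ; zero; suc)
open import Data.Integer as ℤ using (ℤ; +_)
import Data.Integer.Properties as ℤP
open import Data.Rational as ℚ using (ℚ; _/_)
import Data.Rational.Properties as ℚP
open import Data.Fin as Fin using (Fin; toℕ; inject₁)
open import Data.Fin.Permutation using (Permutation′; transpose; _⟨$⟩ʳ_; _⟨$⟩ˡ_)
open import Data.List as List using (List; []; _∷_; upTo; allFin; concatMap; map; filter)
open import Data.List.Relation.Unary.All using (All)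
open import Data.Bool using (Bool; true; false; if_then_else_; _∧_; _xor_)
open import Data.Product using (_×_; _,_)
open import Relation.Nullary using (does; ¬_)
open import Relation.Binary.PropositionalEquality using (_≡_)

-- Points of ℝ^n are represented by rational points (every region is open,
-- so it contains rational points; two generic points lie in the same region
-- iff they are on the same side of every hyperplane).
Point : ℕ → Set
Point n = Fin n → ℚ

intℚ : ℤ → ℚ
intℚ a = a / 1

shifts : ℕ → List ℤ
shifts m = map (λ t → (+ t) ℤ.- (+ m)) (upTo (suc (m ℕ.+ m)))

-- hyperplane H_{i,j,a} = {x : x_i - x_j = a}, stored as (i , j , a)
Hyp : ℕ → Set
Hyp n = Fin n × Fin n × ℤ

catalan : (n m : ℕ) → List (Hyp n)
catalan n m =
  concatMap (λ i → concatMap (λ j → map (λ a → (i , j , a)) (shifts m))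
                                  (filter (λ j → toℕ i ℕ.<? toℕ j) (allFin n)))
            (allFin n)

Generic : {n : ℕ} → ℕ → Point n → Set
Generic {n} m x = All (λ { (i , j , a) → ¬ (x i ℚ.- x j ≡ intℚ a) }) (catalan n m)

posSide : {n : ℕ} → Point n → Hyp n → Bool
posSide x (i , j , a) = does (intℚ a ℚP.<? (x i ℚ.- x j))

separates : {n : ℕ} → Point n → Point n → Hyp n → Bool
separates x y H = posSide x H xor posSide y H

-- a point of R_0: y_k = -k/(n+1), so 0 < y_i - y_j < 1 for i < j
basePoint : (n : ℕ) → Point n
basePoint n k = ℤ.- (+ toℕ k) / suc n

colour : {n : ℕ} → Hyp n → Fin n
colour (i , j , a) = if does (ℤ.0ℤ ℤP.<? a) then j else i

count : {A : Set} → (A → Bool) → List A → ℕ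
count p [] = 0
count p (x ∷ xs) = (if p x then 1 else 0) ℕ.+ count p xs

label : {n : ℕ} → ℕ → Point n → Fin n → ℕ
label {n} m x k =
  suc (count (λ H → separates x (basePoint n) H ∧ does (colour H Fin.≟ k)) (catalan n m))

InFundamental : {n : ℕ} → Point n → Set
InFundamental x = ∀ i j → toℕ i ℕ.< toℕ j → x j ℚ.< x i

act : {n : ℕ} → Permutation′ n → Point n → Point n
act π x k = x (π ⟨$⟩ˡ k)

-- adjacent transposition (i, i+1) in 𝔖_{n+1}, i : Fin n (0-based)
adjT : {n : ℕ} → Fin n → Permutation′ (suc n)
adjT i = transpose (inject₁ i) (Fin.suc i)

δ : {n : ℕ} → Fin n → Fin n → ℕ
δ j k = if does (j Fin.≟ k) then 1 else 0

{-# OPTIONS --safe #-}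
module Submission where

-- Write y = π x and z = ρ x, so that z = y ∘ τ. Pair the hyperplane H_{p,q,a} with
-- H_{τp,τq,a}. When {p,q} ≠ {i,i+1} the pairing keeps p < q, separation from R₀, and
-- the colour up to τ, so these hyperplanes add the same amount to c_k and to b_{τk}.
-- Only the hyperplanes H_{i,i+1,a} behave differently. Suppose d = y_i − y_{i+1} > 0.
-- Then y is separated from R₀ exactly by the ones with 0 < a < d, all of colour i+1,
-- and z exactly by the ones with −d ≤ a ≤ 0, all of colour i. There is one more of the
-- latter (a = 0), because d is not an integer in [1, m]. Hence c = b ∘ τ + e_i. In this
-- case, H_{p,i,a} ↦ H_{p,i+1,a} and H_{i,q,a} ↦ H_{i+1,q,a} inject the colour-i
-- hyperplanes separating y into the colour-(i+1) ones, so b_i ≤ b_{i+1}. If d < 0, the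
-- roles of y and z are exchanged.

open import Defs
open import Data.Nat using (ℕ; suc; _+_; _≤_; _<_)
open import Data.Fin using (Fin; inject₁)
open import Data.Fin.Permutation using (Permutation′; _⟨$⟩ʳ_)
open import Data.Product using (_×_)
open import Relation.Binary.PropositionalEquality using (_≡_)

open import Data.Bool using (Bool; true; false; if_then_else_; _∧_; _xor_; not; T)
open import Data.Bool.Properties using (∧-identityʳ; ∧-zeroʳ; xor-identityʳ; xor-comm; true-xor; T-∧)
open import Data.Empty using (⊥; ⊥-elim)
open import Data.Fin as Fin using (toℕ; _≟_)
import Data.Fin.Permutation as Perm
open import Data.Fin.Permutation using (_⟨$⟩ˡ_)
import Data.Fin.Permutation.Components as PC
import Data.Fin.Properties as FinP
open import Data.Integer as ℤ using (ℤ; -[1+_])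
import Data.Integer.Properties as ℤP
open import Data.List using (List; []; _∷_; _++_; [_]; map; concatMap; filter; tabulate; allFin; upTo; applyUpTo)
open import Data.List.Membership.Propositional using (_∈_; lose)
open import Data.List.Membership.Propositional.Properties using (∈-concatMap⁺; ∈-filter⁺; ∈-allFin; ∈-map⁺; ∈-upTo⁺)
open import Data.List.Properties using (map-++; map-cong; map-applyUpTo; applyUpTo-∷ʳ)
import Data.List.Relation.Unary.All as All
open import Data.Nat as ℕ using (zero; z≤n; s≤s; s≤s⁻¹; _∸_)
open import Data.Nat.ListAction using () renaming (sum to sumˡ)
import Data.Nat.Properties as ℕP
open import Data.Nat.Tactic.RingSolver using (solve-∀)
open import Data.Product using (_,_; proj₁; proj₂)
open import Data.Rational as ℚ using (ℚ; _/_)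
import Data.Rational.Properties as ℚP
import Data.Rational.Unnormalised as ℚᵘ
import Data.Rational.Unnormalised.Properties as ℚᵘP
open import Function using (_∘_; id)
open import Function.Bundles using (Equivalence; mk⇔)
open import Relation.Binary.Definitions using (Tri; tri<; tri≈; tri>)
open import Relation.Binary.PropositionalEquality
  using (_≢_; refl; sym; trans; cong; cong₂; subst; subst₂; module ≡-Reasoning)
open import Relation.Nullary using (does; Dec; ¬_; yes; no; _×-dec_)
open import Relation.Nullary.Decidable using (dec-true; dec-false; does-⇔)
open import Algebra.Properties.CommutativeMonoid.Sum ℕP.+-0-commutativeMonoid
  using (sum; sum-syntax; sum-cong-≗; sum-permute; ∑-distrib-+; sum-replicate-zero)
import Algebra.Properties.Group ℚP.+-0-group as ℚGroup

private variable
  A B : Set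

does-sound : ∀ (A? : Dec A) → T (does A?) → A
does-sound (yes a) _ = a

does-complete : ∀ (A? : Dec A) → A → T (does A?)
does-complete A? a rewrite dec-true A? a = _

not-does-sound : ∀ (A? : Dec A) → T (not (does A?)) → ¬ A
not-does-sound (no ¬a) _ = ¬a

not-does-complete : ∀ (A? : Dec A) → ¬ A → T (not (does A?))
not-does-complete A? ¬a rewrite dec-false A? ¬a = _

count-++ : (P : A → Bool) (xs ys : List A) → count P (xs ++ ys) ≡ count P xs + count P ys
count-++ P []       ys = refl
count-++ P (x ∷ xs) ys =
  trans (cong (_ +_) (count-++ P xs ys)) (sym (ℕP.+-assoc (if P x then 1 else 0) _ _))

count-cong : {P Q : A → Bool} → (∀ x → P x ≡ Q x) → (xs : List A) → count P xs ≡ count Q xs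
count-cong P≗Q []       = refl
count-cong P≗Q (x ∷ xs) = cong₂ (λ b r → (if b then 1 else 0) + r) (P≗Q x) (count-cong P≗Q xs)

count-mono : {P Q : A → Bool} → (∀ x → T (P x) → T (Q x)) → (xs : List A) → count P xs ≤ count Q xs
count-mono                 P⇒Q []       = z≤n
count-mono {P = P} {Q = Q} P⇒Q (x ∷ xs) with P x | Q x | P⇒Q x
... | true  | true  | _   = s≤s (count-mono P⇒Q xs)
... | true  | false | Px⇒ = ⊥-elim (Px⇒ _)
... | false | true  | _   = ℕP.m≤n⇒m≤1+n (count-mono P⇒Q xs)
... | false | false | _   = count-mono P⇒Q xs

count-∧ʳ : (P : A → Bool) (b : Bool) (xs : List A) → count (λ x → P x ∧ b) xs ≡ (if b then count P xs else 0)
count-∧ʳ P true  xs       = count-cong (λ x → ∧-identityʳ (P x)) xs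
count-∧ʳ P false []       = refl
count-∧ʳ P false (x ∷ xs) =
  trans (cong (λ b → (if b then 1 else 0) + _) (∧-zeroʳ (P x))) (count-∧ʳ P false xs)

count-map : (P : B → Bool) (f : A → B) (xs : List A) → count P (map f xs) ≡ count (P ∘ f) xs
count-map P f []       = refl
count-map P f (x ∷ xs) = cong (_ +_) (count-map P f xs)

count-concatMap : (P : B → Bool) (f : A → List B) (xs : List A) →
                  count P (concatMap f xs) ≡ sumˡ (map (count P ∘ f) xs)
count-concatMap P f []       = refl
count-concatMap P f (x ∷ xs) =
  trans (count-++ P (f x) _) (cong (count P (f x) +_) (count-concatMap P f xs))

sum-map-filter : ∀ {Q : A → Set} (Q? : ∀ x → Dec (Q x)) (f : A → ℕ) (xs : List A) →
                 sumˡ (map f (filter Q? xs)) ≡ sumˡ (map (λ x → if does (Q? x) then f x else 0) xs)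
sum-map-filter Q? f []       = refl
sum-map-filter Q? f (x ∷ xs) with does (Q? x)
... | true  = cong (f x +_) (sum-map-filter Q? f xs)
... | false = sum-map-filter Q? f xs

sum-map-tabulate : ∀ {n} (f : A → ℕ) (g : Fin n → A) → sumˡ (map f (tabulate g)) ≡ ∑[ p < n ] f (g p)
sum-map-tabulate {n = zero}  f g = refl
sum-map-tabulate {n = suc n} f g = cong (f (g Fin.zero) +_) (sum-map-tabulate f (g ∘ Fin.suc))

sum-mono : ∀ {n} {f g : Fin n → ℕ} → (∀ p → f p ≤ g p) → sum f ≤ sum g
sum-mono {zero}  f≤g = z≤n
sum-mono {suc n} f≤g = ℕP.+-mono-≤ (f≤g Fin.zero) (sum-mono (f≤g ∘ Fin.suc))

sum-select : ∀ {n} (b : Fin n) (v : ℕ) → ∑[ q < n ] (if does (q ≟ b) then v else 0) ≡ v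
sum-select {suc n} Fin.zero    v = trans (cong (v +_) (sum-replicate-zero n)) (ℕP.+-identityʳ v)
sum-select {suc n} (Fin.suc b) v = sum-select b v

sum₂ : ∀ {n} → (Fin n → Fin n → ℕ) → ℕ
sum₂ {n} f = ∑[ p < n ] ∑[ q < n ] f p q

sum₂-mono : ∀ {n} {f g : Fin n → Fin n → ℕ} → (∀ p q → f p q ≤ g p q) → sum₂ f ≤ sum₂ g
sum₂-mono f≤g = sum-mono (λ p → sum-mono (f≤g p))

sum₂-cong : ∀ {n} {f g : Fin n → Fin n → ℕ} → (∀ p q → f p q ≡ g p q) → sum₂ f ≡ sum₂ g
sum₂-cong f≗g = sum-cong-≗ (λ p → sum-cong-≗ (f≗g p))

sum₂-+ : ∀ {n} (f g : Fin n → Fin n → ℕ) → sum₂ (λ p q → f p q + g p q) ≡ sum₂ f + sum₂ g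
sum₂-+ f g = trans (sum-cong-≗ (λ p → ∑-distrib-+ (f p) (g p))) (∑-distrib-+ (sum ∘ f) (sum ∘ g))

sum₂-permute : ∀ {n} (f : Fin n → Fin n → ℕ) (σ : Permutation′ n) →
               sum₂ f ≡ sum₂ (λ p q → f (σ ⟨$⟩ʳ p) (σ ⟨$⟩ʳ q))
sum₂-permute f σ = trans (sum-permute (sum ∘ f) σ) (sum-cong-≗ (λ p → sum-permute (f (σ ⟨$⟩ʳ p)) σ))

pointMass : ∀ {n} → Fin n → Fin n → ℕ → Fin n → Fin n → ℕ
pointMass a b v p q = if does (p ≟ a) ∧ does (q ≟ b) then v else 0

pointMass-at : ∀ {n} (a b : Fin n) (v : ℕ) → pointMass a b v a b ≡ v
pointMass-at a b v rewrite dec-true (a ≟ a) refl | dec-true (b ≟ b) refl = refl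

pointMass-off : ∀ {n} {a b p q : Fin n} (v : ℕ) → ¬ (p ≡ a × q ≡ b) → pointMass a b v p q ≡ 0
pointMass-off {a = a} {b} {p} {q} v ≢ab with p ≟ a | q ≟ b
... | yes p≡a | yes q≡b = ⊥-elim (≢ab (p≡a , q≡b))
... | yes _   | no _    = refl
... | no _    | _       = refl

sum₂-pointMass : ∀ {n} (a b : Fin n) (v : ℕ) → sum₂ (pointMass a b v) ≡ v
sum₂-pointMass {n} a b v = trans (sum-cong-≗ row) (sum-select a v)
  where
  row : ∀ p → ∑[ q < n ] pointMass a b v p q ≡ (if does (p ≟ a) then v else 0)
  row p with does (p ≟ a)
  ... | true  = sum-select b v
  ... | false = sum-replicate-zero n

sum₂-agreeOff : ∀ {n} {a b : Fin n} (f g : Fin n → Fin n → ℕ) → a ≢ b →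
                (∀ p q → ¬ (p ≡ a × q ≡ b) → ¬ (p ≡ b × q ≡ a) → f p q ≡ g p q) →
                sum₂ f + (g a b + g b a) ≡ sum₂ g + (f a b + f b a)
sum₂-agreeOff {n} {a} {b} f g a≢b agree = begin
  sum₂ f + (g a b + g b a)             ≡⟨ sum₂-withMasses f (g a b) (g b a) ⟨
  sum₂ (withMasses f (g a b) (g b a))  ≡⟨ sum₂-cong pointwise ⟩
  sum₂ (withMasses g (f a b) (f b a))  ≡⟨ sum₂-withMasses g (f a b) (f b a) ⟩
  sum₂ g + (f a b + f b a)             ∎
  where
  open ≡-Reasoning

  withMasses : (Fin n → Fin n → ℕ) → ℕ → ℕ → Fin n → Fin n → ℕ
  withMasses h u v p q = h p q + (pointMass a b u p q + pointMass b a v p q)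

  sum₂-withMasses : ∀ h u v → sum₂ (withMasses h u v) ≡ sum₂ h + (u + v)
  sum₂-withMasses h u v = begin
    sum₂ (withMasses h u v)                                     ≡⟨ sum₂-+ h _ ⟩
    sum₂ h + sum₂ (λ p q → pointMass a b u p q + pointMass b a v p q)
      ≡⟨ cong (sum₂ h +_) (sum₂-+ (pointMass a b u) (pointMass b a v)) ⟩
    sum₂ h + (sum₂ (pointMass a b u) + sum₂ (pointMass b a v))
      ≡⟨ cong₂ (λ s t → sum₂ h + (s + t)) (sum₂-pointMass a b u) (sum₂-pointMass b a v) ⟩
    sum₂ h + (u + v)                                            ∎

  swap-sides : ∀ x y → x + (y + 0) ≡ y + (x + 0)
  swap-sides = solve-∀

  at-ab : withMasses f (g a b) (g b a) a b ≡ withMasses g (f a b) (f b a) a b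
  at-ab rewrite pointMass-at a b (g a b) | pointMass-at a b (f a b)
              | pointMass-off {a = b} {a} {a} {b} (g b a) (a≢b ∘ proj₁)
              | pointMass-off {a = b} {a} {a} {b} (f b a) (a≢b ∘ proj₁)
              = swap-sides (f a b) (g a b)

  at-ba : withMasses f (g a b) (g b a) b a ≡ withMasses g (f a b) (f b a) b a
  at-ba rewrite pointMass-at b a (g b a) | pointMass-at b a (f b a)
              | pointMass-off {a = a} {b} {b} {a} (g a b) (a≢b ∘ sym ∘ proj₁)
              | pointMass-off {a = a} {b} {b} {a} (f a b) (a≢b ∘ sym ∘ proj₁)
              = ℕP.+-comm (f b a) (g b a)

  pointwise : ∀ p q → withMasses f (g a b) (g b a) p q ≡ withMasses g (f a b) (f b a) p q
  pointwise p q with (p ≟ a) ×-dec (q ≟ b) | (p ≟ b) ×-dec (q ≟ a)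
  ... | yes (refl , refl) | _                 = at-ab
  ... | no _              | yes (refl , refl) = at-ba
  ... | no ≢ab            | no ≢ba            = cong₂ _+_ (agree p q ≢ab ≢ba)
      (cong₂ _+_ (trans (pointMass-off _ ≢ab) (sym (pointMass-off _ ≢ab)))
                 (trans (pointMass-off _ ≢ba) (sym (pointMass-off _ ≢ba))))

module _ {n : ℕ} {a b : Fin n} where

  transpose-first : PC.transpose a b a ≡ b
  transpose-first rewrite dec-true (a ≟ a) refl = refl

  transpose-second : a ≢ b → PC.transpose a b b ≡ a
  transpose-second a≢b rewrite dec-false (b ≟ a) (a≢b ∘ sym) | dec-true (b ≟ b) refl = refl

  transpose-other : ∀ {k} → k ≢ a → k ≢ b → PC.transpose a b k ≡ k
  transpose-other {k} k≢a k≢b rewrite dec-false (k ≟ a) k≢a | dec-false (k ≟ b) k≢b = refl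

module AdjacentTransposition {n : ℕ} (i : Fin n) where

  I J : Fin (suc n)
  I = inject₁ i
  J = Fin.suc i

  τ : Fin (suc n) → Fin (suc n)
  τ = adjT i ⟨$⟩ʳ_

  I<J : toℕ I < toℕ J
  I<J = s≤s (ℕP.≤-reflexive (FinP.toℕ-inject₁ i))

  I≢J : I ≢ J
  I≢J I≡J = ℕP.<-irrefl (cong toℕ I≡J) I<J

  τ-I : τ I ≡ J
  τ-I = transpose-first {a = I}

  τ-J : τ J ≡ I
  τ-J = transpose-second I≢J

  τ-other : ∀ {k} → k ≢ I → k ≢ J → τ k ≡ k
  τ-other = transpose-other {a = I} {b = J}

  data Position (k : Fin (suc n)) : Set where
    at-I  : k ≡ I → Position k
    at-J  : k ≡ J → Position k
    other : k ≢ I → k ≢ J → Position k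

  position : ∀ k → Position k
  position k with k ≟ I | k ≟ J
  ... | yes k≡I | _       = at-I k≡I
  ... | no k≢I  | yes k≡J = at-J k≡J
  ... | no k≢I  | no k≢J  = other k≢I k≢J

  τ-involutive : ∀ k → τ (τ k) ≡ k
  τ-involutive k with position k
  ... | at-I refl      = trans (cong τ τ-I) τ-J
  ... | at-J refl      = trans (cong τ τ-J) τ-I
  ... | other k≢I k≢J  = trans (cong τ (τ-other k≢I k≢J)) (τ-other k≢I k≢J)

  τ⁻¹≡τ : ∀ k → adjT i ⟨$⟩ˡ k ≡ τ k
  τ⁻¹≡τ k = trans (cong (adjT i ⟨$⟩ˡ_) (sym (τ-involutive k))) (Perm.inverseˡ (adjT i))

  τ-preserves-< : ∀ {p q} → ¬ (p ≡ I × q ≡ J) → toℕ p < toℕ q → toℕ (τ p) < toℕ (τ q)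
  τ-preserves-< {p} {q} ≢IJ p<q with position p | position q
  ... | at-I refl | at-I refl = ⊥-elim (ℕP.<-irrefl refl p<q)
  ... | at-I refl | at-J refl = ⊥-elim (≢IJ (refl , refl))
  ... | at-J refl | at-I refl = ⊥-elim (ℕP.<-asym p<q I<J)
  ... | at-J refl | at-J refl = ⊥-elim (ℕP.<-irrefl refl p<q)
  ... | at-I refl | other q≢I q≢J rewrite τ-I | τ-other q≢I q≢J =
    ℕP.≤∧≢⇒< (subst (_< toℕ q) (FinP.toℕ-inject₁ i) p<q) (q≢J ∘ FinP.toℕ-injective ∘ sym)
  ... | at-J refl | other q≢I q≢J rewrite τ-J | τ-other q≢I q≢J = ℕP.<-trans I<J p<q
  ... | other p≢I p≢J | at-I refl rewrite τ-I | τ-other p≢I p≢J = ℕP.<-trans p<q I<J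
  ... | other p≢I p≢J | at-J refl rewrite τ-J | τ-other p≢I p≢J =
    ℕP.≤∧≢⇒< (ℕP.≤-trans (s≤s⁻¹ p<q) (ℕP.≤-reflexive (sym (FinP.toℕ-inject₁ i)))) (p≢I ∘ FinP.toℕ-injective)
  ... | other p≢I p≢J | other q≢I q≢J rewrite τ-other p≢I p≢J | τ-other q≢I q≢J = p<q

  τ-injective : ∀ {k l} → τ k ≡ τ l → k ≡ l
  τ-injective {k} {l} τk≡τl = trans (sym (τ-involutive k)) (trans (cong τ τk≡τl) (τ-involutive l))

  τ-reflects-< : ∀ {p q} → ¬ (p ≡ J × q ≡ I) → toℕ (τ p) < toℕ (τ q) → toℕ p < toℕ q
  τ-reflects-< {p} {q} ≢JI τp<τq = subst₂ (λ u v → toℕ u < toℕ v) (τ-involutive p) (τ-involutive q)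
    (τ-preserves-< (λ (τp≡I , τq≡J) → ≢JI (τ-injective (trans τp≡I (sym τ-J)) ,
                                           τ-injective (trans τq≡J (sym τ-I))))
                   τp<τq)

  τ-≟ : ∀ k l → does (τ k ≟ τ l) ≡ does (k ≟ l)
  τ-≟ k l = does-⇔ (mk⇔ τ-injective (cong τ)) (τ k ≟ τ l) (k ≟ l)

<-by-cross-multiplication : ∀ (a b : ℤ) (k l : ℕ) →
  a ℤ.* ℤ.+ suc l ℤ.< b ℤ.* ℤ.+ suc k → a / suc k ℚ.< b / suc l
<-by-cross-multiplication a b k l a*l<b*k = ℚP.toℚᵘ-cancel-<
  (ℚᵘP.<-respˡ-≃ (ℚᵘP.≃-sym (ℚP.toℚᵘ-fromℚᵘ (ℚᵘ.mkℚᵘ a k)))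
    (ℚᵘP.<-respʳ-≃ (ℚᵘP.≃-sym (ℚP.toℚᵘ-fromℚᵘ (ℚᵘ.mkℚᵘ b l))) (ℚᵘ.*<* a*l<b*k)))

≤-by-cross-multiplication : ∀ (a b : ℤ) (k l : ℕ) →
  a ℤ.* ℤ.+ suc l ℤ.≤ b ℤ.* ℤ.+ suc k → a / suc k ℚ.≤ b / suc l
≤-by-cross-multiplication a b k l a*l≤b*k = ℚP.toℚᵘ-cancel-≤
  (ℚᵘP.≤-respˡ-≃ (ℚᵘP.≃-sym (ℚP.toℚᵘ-fromℚᵘ (ℚᵘ.mkℚᵘ a k)))
    (ℚᵘP.≤-respʳ-≃ (ℚᵘP.≃-sym (ℚP.toℚᵘ-fromℚᵘ (ℚᵘ.mkℚᵘ b l))) (ℚᵘ.*≤* a*l≤b*k)))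

intℚ-mono-≤ : ∀ {a b} → a ℤ.≤ b → intℚ a ℚ.≤ intℚ b
intℚ-mono-≤ {a} {b} a≤b = ≤-by-cross-multiplication a b 0 0
  (subst₂ ℤ._≤_ (sym (ℤP.*-identityʳ a)) (sym (ℤP.*-identityʳ b)) a≤b)

0<a⇒1≤intℚ : ∀ {a} → ℤ.0ℤ ℤ.< a → ℚ.1ℚ ℚ.≤ intℚ a
0<a⇒1≤intℚ 0<a = intℚ-mono-≤ (ℤP.i<j⇒suc[i]≤j 0<a)

p<q⇒0<q-p : ∀ {p q} → p ℚ.< q → ℚ.0ℚ ℚ.< q ℚ.- p
p<q⇒0<q-p {p} {q} p<q = subst (ℚ._< q ℚ.- p) (ℚP.+-inverseʳ p) (ℚP.+-monoˡ-< (ℚ.- p) p<q)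

neg-difference : ∀ p q → ℚ.- (p ℚ.- q) ≡ q ℚ.- p
neg-difference p q = trans (ℚGroup.⁻¹-anti-homo-∙ p (ℚ.- q)) (cong (ℚ._- p) (ℚGroup.⁻¹-involutive q))

basePoint-gap : ∀ {n} {p q : Fin n} → toℕ p < toℕ q →
  ℚ.0ℚ ℚ.< basePoint n p ℚ.- basePoint n q × basePoint n p ℚ.- basePoint n q ℚ.< ℚ.1ℚ
basePoint-gap {n} {p} {q} p<q = p<q⇒0<q-p bq<bp , ℚP.+-mono-≤-< bp≤0 (ℚP.neg-antimono-< -1<bq)
  where
  bq<bp : basePoint n q ℚ.< basePoint n p
  bq<bp = <-by-cross-multiplication (ℤ.- ℤ.+ toℕ q) (ℤ.- ℤ.+ toℕ p) n n
    (ℤP.*-monoʳ-<-pos (ℤ.+ suc n) (ℤP.neg-mono-< (ℤ.+<+ p<q)))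
  bp≤0 : basePoint n p ℚ.≤ ℚ.0ℚ
  bp≤0 = ≤-by-cross-multiplication (ℤ.- ℤ.+ toℕ p) (ℤ.+ 0) n 0
    (subst (ℤ._≤ ℤ.0ℤ) (sym (ℤP.*-identityʳ (ℤ.- ℤ.+ toℕ p))) ℤP.neg-≤-pos)
  -1<bq : ℚ.- ℚ.1ℚ ℚ.< basePoint n q
  -1<bq = <-by-cross-multiplication (ℤ.- ℤ.1ℤ) (ℤ.- ℤ.+ toℕ q) 0 n
    (subst₂ ℤ._<_ (sym (ℤP.-1*i≡-i (ℤ.+ suc n))) (sym (ℤP.*-identityʳ (ℤ.- ℤ.+ toℕ q)))
      (ℤP.neg-mono-< (ℤ.+<+ (ℕP.m<n⇒m<1+n (FinP.toℕ<n q)))))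

basePoint-posSide : ∀ {n} {p q : Fin n} → toℕ p < toℕ q →
  ∀ a → posSide (basePoint n) (p , q , a) ≡ not (does (ℤ.0ℤ ℤP.<? a))
basePoint-posSide p<q a with ℤ.0ℤ ℤP.<? a
... | yes 0<a = dec-false (intℚ a ℚP.<? _) λ a<gap →
  ℚP.<-irrefl refl (ℚP.≤-<-trans (0<a⇒1≤intℚ 0<a) (ℚP.<-trans a<gap (proj₂ (basePoint-gap p<q))))
... | no  0≮a = dec-true (intℚ a ℚP.<? _)
  (ℚP.≤-<-trans (intℚ-mono-≤ (ℤP.≮⇒≥ 0≮a)) (proj₁ (basePoint-gap p<q)))

colour-pos : ∀ {n} {p q : Fin n} {a} → ℤ.0ℤ ℤ.< a → colour (p , q , a) ≡ q
colour-pos {p = p} {q} {a} 0<a = cong (if_then q else p) (dec-true (ℤ.0ℤ ℤP.<? a) 0<a)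

colour-nonpos : ∀ {n} {p q : Fin n} {a} → ¬ ℤ.0ℤ ℤ.< a → colour (p , q , a) ≡ p
colour-nonpos {p = p} {q} {a} 0≮a = cong (if_then q else p) (dec-false (ℤ.0ℤ ℤP.<? a) 0≮a)

separatesWithColour : ∀ {n} → Point n → Fin n → Hyp n → Bool
separatesWithColour {n} w k H = separates w (basePoint n) H ∧ does (colour H ≟ k)

separatesWithColour⇒colour : ∀ {n} (w : Point n) (k : Fin n) (H : Hyp n) →
  T (separatesWithColour w k H) → colour H ≡ k
separatesWithColour⇒colour w k H sep = does-sound (colour H ≟ k) (proj₂ (Equivalence.to T-∧ sep))

module _ {n} (w : Point n) (k : Fin n) {p q : Fin n} {a : ℤ} (p<q : toℕ p < toℕ q) where

  separatesWithColour-pos : ℤ.0ℤ ℤ.< a →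
    separatesWithColour w k (p , q , a) ≡ posSide w (p , q , a) ∧ does (q ≟ k)
  separatesWithColour-pos 0<a = cong₂ _∧_
    (trans (cong (posSide w (p , q , a) xor_)
                 (trans (basePoint-posSide p<q a) (cong not (dec-true (ℤ.0ℤ ℤP.<? a) 0<a))))
           (xor-identityʳ _))
    (cong (λ c → does (c ≟ k)) (colour-pos 0<a))

  separatesWithColour-nonpos : ¬ ℤ.0ℤ ℤ.< a →
    separatesWithColour w k (p , q , a) ≡ not (posSide w (p , q , a)) ∧ does (p ≟ k)
  separatesWithColour-nonpos 0≮a = cong₂ _∧_
    (trans (cong (posSide w (p , q , a) xor_)
                 (trans (basePoint-posSide p<q a) (cong not (dec-false (ℤ.0ℤ ℤP.<? a) 0≮a))))
           (trans (xor-comm _ true) (true-xor _)))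
    (cong (λ c → does (c ≟ k)) (colour-nonpos 0≮a))

separatesWithColour-transport : ∀ {n} (σ : Permutation′ n) (w w′ : Point n) → (∀ u → w′ (σ ⟨$⟩ʳ u) ≡ w u) →
  ∀ k {p q a} → toℕ p < toℕ q → toℕ (σ ⟨$⟩ʳ p) < toℕ (σ ⟨$⟩ʳ q) →
  separatesWithColour w′ k (σ ⟨$⟩ʳ p , σ ⟨$⟩ʳ q , a) ≡ separatesWithColour w (σ ⟨$⟩ˡ k) (p , q , a)
separatesWithColour-transport σ w w′ w′∘σ≗w k {p} {q} {a} p<q σp<σq = cong₂ _∧_
  (cong₂ _xor_ (cong₂ (λ s t → does (intℚ a ℚP.<? s ℚ.- t)) (w′∘σ≗w p) (w′∘σ≗w q))
               (trans (basePoint-posSide σp<σq a) (sym (basePoint-posSide p<q a))))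
  σ-colour
  where
  σ-≟ : ∀ c → does (σ ⟨$⟩ʳ c ≟ k) ≡ does (c ≟ σ ⟨$⟩ˡ k)
  σ-≟ c = does-⇔ (mk⇔ (λ σc≡k → trans (sym (Perm.inverseˡ σ)) (cong (σ ⟨$⟩ˡ_) σc≡k))
                      (λ c≡σ⁻¹k → trans (cong (σ ⟨$⟩ʳ_) c≡σ⁻¹k) (Perm.inverseʳ σ)))
                 (σ ⟨$⟩ʳ c ≟ k) (c ≟ σ ⟨$⟩ˡ k)
  σ-colour : does ((if does (ℤ.0ℤ ℤP.<? a) then σ ⟨$⟩ʳ q else σ ⟨$⟩ʳ p) ≟ k)
           ≡ does ((if does (ℤ.0ℤ ℤP.<? a) then q else p) ≟ σ ⟨$⟩ˡ k)
  σ-colour with does (ℤ.0ℤ ℤP.<? a)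
  ... | true  = σ-≟ q
  ... | false = σ-≟ p

separatingCount : ∀ {n} → ℕ → Point n → Fin n → ℕ
separatingCount {n} m w k = count (separatesWithColour w k) (catalan n m)

pairCount : ∀ {n} → (Hyp n → Bool) → ℕ → Fin n → Fin n → ℕ
pairCount P m p q = if does (toℕ p ℕ.<? toℕ q) then count P (map (λ a → (p , q , a)) (shifts m)) else 0

count-catalan : ∀ {n} (P : Hyp n → Bool) (m : ℕ) → count P (catalan n m) ≡ sum₂ (pairCount P m)
count-catalan {n} P m = begin
  count P (catalan n m)                  ≡⟨ count-concatMap P row (allFin n) ⟩
  sumˡ (map (count P ∘ row) (allFin n))  ≡⟨ sum-map-tabulate (count P ∘ row) id ⟩
  ∑[ p < n ] count P (row p)             ≡⟨ sum-cong-≗ row-count ⟩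
  sum₂ (pairCount P m)                   ∎
  where
  open ≡-Reasoning
  cell : Fin n → Fin n → List (Hyp n)
  cell p q = map (λ a → (p , q , a)) (shifts m)
  row : Fin n → List (Hyp n)
  row p = concatMap (cell p) (filter (λ q → toℕ p ℕ.<? toℕ q) (allFin n))
  row-count : ∀ p → count P (row p) ≡ ∑[ q < n ] pairCount P m p q
  row-count p = begin
    count P (row p)
      ≡⟨ count-concatMap P (cell p) (filter (λ q → toℕ p ℕ.<? toℕ q) (allFin n)) ⟩
    sumˡ (map (count P ∘ cell p) (filter (λ q → toℕ p ℕ.<? toℕ q) (allFin n)))
      ≡⟨ sum-map-filter (λ q → toℕ p ℕ.<? toℕ q) (count P ∘ cell p) (allFin n) ⟩
    sumˡ (map (pairCount P m p) (allFin n))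
      ≡⟨ sum-map-tabulate (pairCount P m p) id ⟩
    ∑[ q < n ] pairCount P m p q ∎

module _ {n} (P : Hyp n → Bool) (m : ℕ) {p q : Fin n} where

  pairCount-< : toℕ p < toℕ q → pairCount P m p q ≡ count (λ a → P (p , q , a)) (shifts m)
  pairCount-< p<q rewrite dec-true (toℕ p ℕ.<? toℕ q) p<q = count-map P _ (shifts m)

  pairCount-≮ : ¬ toℕ p < toℕ q → pairCount P m p q ≡ 0
  pairCount-≮ p≮q rewrite dec-false (toℕ p ℕ.<? toℕ q) p≮q = refl

posBelow : ℚ → ℤ → Bool
posBelow d a = does (ℤ.0ℤ ℤP.<? a) ∧ does (intℚ a ℚP.<? d)

nonposAtLeastNeg : ℚ → ℤ → Bool
nonposAtLeastNeg d a = not (does (ℤ.0ℤ ℤP.<? a)) ∧ not (does (intℚ a ℚP.<? ℚ.- d))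

module _ (d : ℚ) {a : ℤ} where

  posBelow-pos : ℤ.0ℤ ℤ.< a → posBelow d a ≡ does (intℚ a ℚP.<? d)
  posBelow-pos 0<a = cong (_∧ does (intℚ a ℚP.<? d)) (dec-true (ℤ.0ℤ ℤP.<? a) 0<a)

  posBelow-nonpos : ¬ ℤ.0ℤ ℤ.< a → posBelow d a ≡ false
  posBelow-nonpos 0≮a = cong (_∧ does (intℚ a ℚP.<? d)) (dec-false (ℤ.0ℤ ℤP.<? a) 0≮a)

  nonposAtLeastNeg-pos : ℤ.0ℤ ℤ.< a → nonposAtLeastNeg d a ≡ false
  nonposAtLeastNeg-pos 0<a = cong (λ b → not b ∧ not (does (intℚ a ℚP.<? ℚ.- d))) (dec-true (ℤ.0ℤ ℤP.<? a) 0<a)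

  nonposAtLeastNeg-nonpos : ¬ ℤ.0ℤ ℤ.< a → nonposAtLeastNeg d a ≡ not (does (intℚ a ℚP.<? ℚ.- d))
  nonposAtLeastNeg-nonpos 0≮a = cong (λ b → not b ∧ not (does (intℚ a ℚP.<? ℚ.- d))) (dec-false (ℤ.0ℤ ℤP.<? a) 0≮a)

module _ {n} (m : ℕ) (w : Point n) (k : Fin n) {p q : Fin n} (p<q : toℕ p < toℕ q) where

  private
    gap : ℚ
    gap = w p ℚ.- w q

  pairCount-positiveGap : ℚ.0ℚ ℚ.< gap →
    pairCount (separatesWithColour w k) m p q ≡ (if does (q ≟ k) then count (posBelow gap) (shifts m) else 0)
  pairCount-positiveGap 0<gap = trans (pairCount-< (separatesWithColour w k) m p<q)
    (trans (count-cong pointwise (shifts m)) (count-∧ʳ (posBelow gap) (does (q ≟ k)) (shifts m)))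
    where
    pointwise : ∀ a → separatesWithColour w k (p , q , a) ≡ posBelow gap a ∧ does (q ≟ k)
    pointwise a = by-sign (ℤ.0ℤ ℤP.<? a)
      where
      open ≡-Reasoning
      by-sign : Dec (ℤ.0ℤ ℤ.< a) → separatesWithColour w k (p , q , a) ≡ posBelow gap a ∧ does (q ≟ k)
      by-sign (yes 0<a) = begin
        separatesWithColour w k (p , q , a)  ≡⟨ separatesWithColour-pos w k p<q 0<a ⟩
        posSide w (p , q , a) ∧ does (q ≟ k) ≡⟨ cong (_∧ does (q ≟ k)) (posBelow-pos gap 0<a) ⟨
        posBelow gap a ∧ does (q ≟ k)        ∎
      by-sign (no 0≮a) = begin
        separatesWithColour w k (p , q , a)        ≡⟨ separatesWithColour-nonpos w k p<q 0≮a ⟩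
        not (posSide w (p , q , a)) ∧ does (p ≟ k) ≡⟨ cong (λ b → not b ∧ does (p ≟ k)) (dec-true (intℚ a ℚP.<? gap)
                                                        (ℚP.≤-<-trans (intℚ-mono-≤ (ℤP.≮⇒≥ 0≮a)) 0<gap)) ⟩
        false                                      ≡⟨ cong (_∧ does (q ≟ k)) (posBelow-nonpos gap 0≮a) ⟨
        posBelow gap a ∧ does (q ≟ k)              ∎

  pairCount-negativeGap : ∀ {d} → ℚ.0ℚ ℚ.< d → gap ≡ ℚ.- d →
    pairCount (separatesWithColour w k) m p q ≡ (if does (p ≟ k) then count (nonposAtLeastNeg d) (shifts m) else 0)
  pairCount-negativeGap {d} 0<d gap≡-d = trans (pairCount-< (separatesWithColour w k) m p<q)
    (trans (count-cong pointwise (shifts m)) (count-∧ʳ (nonposAtLeastNeg d) (does (p ≟ k)) (shifts m)))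
    where
    pointwise : ∀ a → separatesWithColour w k (p , q , a) ≡ nonposAtLeastNeg d a ∧ does (p ≟ k)
    pointwise a = by-sign (ℤ.0ℤ ℤP.<? a)
      where
      open ≡-Reasoning
      by-sign : Dec (ℤ.0ℤ ℤ.< a) → separatesWithColour w k (p , q , a) ≡ nonposAtLeastNeg d a ∧ does (p ≟ k)
      by-sign (yes 0<a) = begin
        separatesWithColour w k (p , q , a)  ≡⟨ separatesWithColour-pos w k p<q 0<a ⟩
        posSide w (p , q , a) ∧ does (q ≟ k) ≡⟨ cong (_∧ does (q ≟ k)) (dec-false (intℚ a ℚP.<? gap) a≮gap) ⟩
        false                                ≡⟨ cong (_∧ does (p ≟ k)) (nonposAtLeastNeg-pos d 0<a) ⟨
        nonposAtLeastNeg d a ∧ does (p ≟ k)  ∎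
        where
        a≮gap : ¬ intℚ a ℚ.< gap
        a≮gap a<gap = ℚP.<-asym a<gap (subst (ℚ._< intℚ a) (sym gap≡-d)
          (ℚP.<-≤-trans (ℚP.neg-antimono-< 0<d) (intℚ-mono-≤ (ℤP.<⇒≤ 0<a))))
      by-sign (no 0≮a) = begin
        separatesWithColour w k (p , q , a)              ≡⟨ separatesWithColour-nonpos w k p<q 0≮a ⟩
        not (posSide w (p , q , a)) ∧ does (p ≟ k)       ≡⟨ cong (λ g → not (does (intℚ a ℚP.<? g)) ∧ does (p ≟ k)) gap≡-d ⟩
        not (does (intℚ a ℚP.<? ℚ.- d)) ∧ does (p ≟ k)  ≡⟨ cong (_∧ does (p ≟ k)) (nonposAtLeastNeg-nonpos d 0≮a) ⟨
        nonposAtLeastNeg d a ∧ does (p ≟ k)              ∎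

shifts-suc : ∀ m → shifts (suc m) ≡ -[1+ m ] ∷ (shifts m ++ [ ℤ.+ suc m ])
shifts-suc m = begin
  map f (upTo (suc (suc m + suc m)))                 ≡⟨ cong (λ l → map f (upTo (suc (suc l)))) (ℕP.+-suc m m) ⟩
  f 0 ∷ map f (applyUpTo suc (suc (suc K)))          ≡⟨ cong (λ l → f 0 ∷ map f l) (sym (applyUpTo-∷ʳ suc (suc K))) ⟩
  f 0 ∷ map f (applyUpTo suc (suc K) ++ [ suc (suc K) ])
                                                     ≡⟨ cong (f 0 ∷_) (map-++ f (applyUpTo suc (suc K)) _) ⟩
  f 0 ∷ (map f (applyUpTo suc (suc K)) ++ [ f (suc (suc K)) ])
                                                     ≡⟨ cong₂ (λ l c → f 0 ∷ (l ++ [ c ])) middle last ⟩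
  -[1+ m ] ∷ (shifts m ++ [ ℤ.+ suc m ])        ∎
  where
  open ≡-Reasoning
  K = m + m
  f : ℕ → ℤ
  f t = ℤ.+ t ℤ.- ℤ.+ suc m
  suc-minus-suc : ∀ t → f (suc t) ≡ ℤ.+ t ℤ.- ℤ.+ m
  suc-minus-suc t = begin
    f (suc t)            ≡⟨ ℤP.m-n≡m⊖n (suc t) (suc m) ⟩
    suc t ℤ.⊖ suc m      ≡⟨ ℤP.[1+m]⊖[1+n]≡m⊖n t m ⟩
    t ℤ.⊖ m              ≡⟨ ℤP.m-n≡m⊖n t m ⟨
    ℤ.+ t ℤ.- ℤ.+ m      ∎
  middle : map f (applyUpTo suc (suc K)) ≡ shifts m
  middle = begin
    map f (applyUpTo suc (suc K))            ≡⟨ map-applyUpTo suc f (suc K) ⟩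
    applyUpTo (f ∘ suc) (suc K)              ≡⟨ map-applyUpTo id (f ∘ suc) (suc K) ⟨
    map (f ∘ suc) (upTo (suc K))             ≡⟨ map-cong suc-minus-suc (upTo (suc K)) ⟩
    shifts m                                 ∎
  last : f (suc (suc K)) ≡ ℤ.+ suc m
  last = begin
    f (suc (suc K))         ≡⟨ ℤP.m-n≡m⊖n (suc (suc K)) (suc m) ⟩
    suc (suc K) ℤ.⊖ suc m   ≡⟨ ℤP.[1+m]⊖[1+n]≡m⊖n (suc K) m ⟩
    suc m + m ℤ.⊖ m         ≡⟨ ℤP.⊖-≥ (ℕP.m≤n+m m (suc m)) ⟩
    ℤ.+ (suc m + m ∸ m)     ≡⟨ cong ℤ.+_ (ℕP.m+n∸n≡m (suc m) m) ⟩
    ℤ.+ suc m               ∎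

-- a = 0 is the surplus term; a = −c with c ≥ 1 is counted iff c ≤ d, which agrees with c < d as d ≠ c.
count-nonposAtLeastNeg : ∀ {d} m → ℚ.0ℚ ℚ.< d → (∀ c → c ≤ m → d ≢ intℚ (ℤ.+ c)) →
  count (nonposAtLeastNeg d) (shifts m) ≡ suc (count (posBelow d) (shifts m))
count-nonposAtLeastNeg {d} zero 0<d _ = cong (λ b → (if not b then 1 else 0) + 0)
  (dec-false (ℚ.0ℚ ℚP.<? ℚ.- d) (ℚP.<-asym (ℚP.neg-antimono-< 0<d)))
count-nonposAtLeastNeg {d} (suc m) 0<d avoids = begin
  count N (shifts (suc m))
    ≡⟨ cong (count N) (shifts-suc m) ⟩
  bit (N -[1+ m ]) + count N (shifts m ++ [ ℤ.+ suc m ])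
    ≡⟨ cong (bit (N -[1+ m ]) +_) (count-++ N (shifts m) _) ⟩
  bit (N -[1+ m ]) + (count N (shifts m) + 0)
    ≡⟨ cong₂ (λ b c → bit b + (c + 0)) flip-sign
             (count-nonposAtLeastNeg m 0<d (λ c c≤m → avoids c (ℕP.m≤n⇒m≤1+n c≤m))) ⟩
  bit (P (ℤ.+ suc m)) + (suc (count P (shifts m)) + 0)
    ≡⟨ shuffle (bit (P (ℤ.+ suc m))) (count P (shifts m)) ⟩
  suc (count P (shifts m) + (bit (P (ℤ.+ suc m)) + 0))
    ≡⟨ cong suc (count-++ P (shifts m) _) ⟨
  suc (count P (shifts m ++ [ ℤ.+ suc m ]))
    ≡⟨ cong (suc ∘ count P) (shifts-suc m) ⟨
  suc (count P (shifts (suc m)))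
    ∎
  where
  open ≡-Reasoning
  N P : ℤ → Bool
  N = nonposAtLeastNeg d
  P = posBelow d
  bit : Bool → ℕ
  bit b = if b then 1 else 0
  shuffle : ∀ b c → b + (suc c + 0) ≡ suc (c + (b + 0))
  shuffle = solve-∀
  flip-sign : N -[1+ m ] ≡ P (ℤ.+ suc m)
  flip-sign with ℚP.<-cmp (intℚ (ℤ.+ suc m)) d
  ... | tri< m<d _ _ = trans (cong not (dec-false (intℚ -[1+ m ] ℚP.<? ℚ.- d)
                              (ℚP.<-asym (ℚP.neg-antimono-< m<d))))
                             (sym (dec-true (intℚ (ℤ.+ suc m) ℚP.<? d) m<d))
  ... | tri≈ _ m≡d _ = ⊥-elim (avoids (suc m) ℕP.≤-refl (sym m≡d))
  ... | tri> _ _ d<m = trans (cong not (dec-true (intℚ -[1+ m ] ℚP.<? ℚ.- d) (ℚP.neg-antimono-< d<m)))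
                             (sym (dec-false (intℚ (ℤ.+ suc m) ℚP.<? d) (ℚP.<-asym d<m)))

generic⇒avoids : ∀ {n m} {x : Point n} → Generic m x → ∀ {u v} → toℕ u < toℕ v →
                 ∀ c → c ≤ m → x u ℚ.- x v ≢ intℚ (ℤ.+ c)
generic⇒avoids {n} {m} generic {u} {v} u<v c c≤m = All.lookup generic u,v,c∈catalan
  where
  c∈shifts : ℤ.+ c ∈ shifts m
  c∈shifts = subst (_∈ shifts m) m+c-m≡c
    (∈-map⁺ (λ t → ℤ.+ t ℤ.- ℤ.+ m) (∈-upTo⁺ (s≤s (ℕP.+-monoʳ-≤ m c≤m))))
    where
    m+c-m≡c : ℤ.+ (m + c) ℤ.- ℤ.+ m ≡ ℤ.+ c
    m+c-m≡c = trans (ℤP.m-n≡m⊖n (m + c) m) (trans (ℤP.⊖-≥ (ℕP.m≤m+n m c)) (cong ℤ.+_ (ℕP.m+n∸m≡n m c)))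
  u,v,c∈catalan : (u , v , ℤ.+ c) ∈ catalan n m
  u,v,c∈catalan = ∈-concatMap⁺ _ (lose (∈-allFin u) (∈-concatMap⁺ _
    (lose (∈-filter⁺ (λ j → toℕ u ℕ.<? toℕ j) (∈-allFin v) u<v) (∈-map⁺ (λ b → (u , v , b)) c∈shifts))))

module SwapAtDescent {n m : ℕ} (i : Fin n) {y z : Point (suc n)}
                    (z≗y∘τ : ∀ k → z k ≡ y (adjT i ⟨$⟩ʳ k))
                    (yJ<yI : y (Fin.suc i) ℚ.< y (inject₁ i))
                    (avoids : ∀ c → c ≤ m → y (inject₁ i) ℚ.- y (Fin.suc i) ≢ intℚ (ℤ.+ c)) where

  open AdjacentTransposition i

  gap : ℚ
  gap = y I ℚ.- y J

  0<gap : ℚ.0ℚ ℚ.< gap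
  0<gap = p<q⇒0<q-p yJ<yI

  below : ℕ
  below = count (posBelow gap) (shifts m)

  z∘τ≗y : ∀ k → z (τ k) ≡ y k
  z∘τ≗y k = trans (z≗y∘τ (τ k)) (cong y (τ-involutive k))

  pairCount-y-IJ : ∀ k → pairCount (separatesWithColour y k) m I J ≡ (if does (J ≟ k) then below else 0)
  pairCount-y-IJ k = pairCount-positiveGap m y k I<J 0<gap

  pairCount-z-IJ : ∀ k → pairCount (separatesWithColour z k) m I J ≡ (if does (I ≟ k) then suc below else 0)
  pairCount-z-IJ k = trans (pairCount-negativeGap m z k I<J 0<gap z-gap)
                           (cong (if does (I ≟ k) then_else 0) (count-nonposAtLeastNeg m 0<gap avoids))
    where
    z-gap : z I ℚ.- z J ≡ ℚ.- gap
    z-gap = trans (cong₂ ℚ._-_ (trans (z≗y∘τ I) (cong y τ-I)) (trans (z≗y∘τ J) (cong y τ-J)))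
                  (sym (neg-difference (y I) (y J)))

  pairCount-JI : ∀ (P : Hyp (suc n) → Bool) → pairCount P m J I ≡ 0
  pairCount-JI P = pairCount-≮ P m (ℕP.<-asym I<J)

  pairCount-transport : ∀ k p q → ¬ (p ≡ I × q ≡ J) → ¬ (p ≡ J × q ≡ I) →
    pairCount (separatesWithColour z k) m (τ p) (τ q) ≡ pairCount (separatesWithColour y (τ k)) m p q
  pairCount-transport k p q ≢IJ ≢JI with toℕ p ℕ.<? toℕ q
  ... | no  p≮q = trans (pairCount-≮ _ m (p≮q ∘ τ-reflects-< ≢JI)) (sym (pairCount-≮ _ m p≮q))
  ... | yes p<q = begin
    pairCount (separatesWithColour z k) m (τ p) (τ q)
      ≡⟨ pairCount-< (separatesWithColour z k) m τp<τq ⟩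
    count (λ a → separatesWithColour z k (τ p , τ q , a)) (shifts m)
      ≡⟨ count-cong (λ a → trans (separatesWithColour-transport (adjT i) y z z∘τ≗y k {a = a} p<q τp<τq)
                                 (cong (λ l → separatesWithColour y l (p , q , a)) (τ⁻¹≡τ k))) (shifts m) ⟩
    count (λ a → separatesWithColour y (τ k) (p , q , a)) (shifts m)
      ≡⟨ pairCount-< (separatesWithColour y (τ k)) m p<q ⟨
    pairCount (separatesWithColour y (τ k)) m p q ∎
    where
    open ≡-Reasoning
    τp<τq = τ-preserves-< ≢IJ p<q

  label-transpose : ∀ k → label m z k ≡ label m y (τ k) + δ I k
  label-transpose k = cong suc (cancel (does (I ≟ k))
    (subst₂ (λ u v → separatingCount m z k + u ≡ separatingCount m y (τ k) + v)
            (cong₂ _+_ F-IJ (pairCount-JI (separatesWithColour y (τ k)))) (cong₂ _+_ G-IJ G-JI) exchange))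
    where
    open ≡-Reasoning
    G F : Fin (suc n) → Fin (suc n) → ℕ
    G p q = pairCount (separatesWithColour z k) m (τ p) (τ q)
    F = pairCount (separatesWithColour y (τ k)) m

    exchange : separatingCount m z k + (F I J + F J I) ≡ separatingCount m y (τ k) + (G I J + G J I)
    exchange = begin
      separatingCount m z k + (F I J + F J I)
        ≡⟨ cong (_+ (F I J + F J I)) (trans (count-catalan (separatesWithColour z k) m)
                                            (sum₂-permute (pairCount (separatesWithColour z k) m) (adjT i))) ⟩
      sum₂ G + (F I J + F J I)   ≡⟨ sum₂-agreeOff G F I≢J (pairCount-transport k) ⟩
      sum₂ F + (G I J + G J I)   ≡⟨ cong (_+ (G I J + G J I)) (count-catalan (separatesWithColour y (τ k)) m) ⟨
      separatingCount m y (τ k) + (G I J + G J I) ∎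

    F-IJ : F I J ≡ (if does (I ≟ k) then below else 0)
    F-IJ = trans (pairCount-y-IJ (τ k))
                 (cong (if_then below else 0) (trans (cong (λ j → does (j ≟ τ k)) (sym τ-I)) (τ-≟ I k)))

    G-IJ : G I J ≡ 0
    G-IJ = trans (cong₂ (pairCount (separatesWithColour z k) m) τ-I τ-J)
                 (pairCount-JI (separatesWithColour z k))

    G-JI : G J I ≡ (if does (I ≟ k) then suc below else 0)
    G-JI = trans (cong₂ (pairCount (separatesWithColour z k) m) τ-J τ-I) (pairCount-z-IJ k)

    cancel : ∀ b {s t} → s + ((if b then below else 0) + 0) ≡ t + (0 + (if b then suc below else 0)) →
             s ≡ t + (if b then 1 else 0)
    cancel true  {s} {t} eq = ℕP.+-cancelʳ-≡ below s (t + 1)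
      (trans (cong (s +_) (sym (ℕP.+-identityʳ below))) (trans eq (sym (ℕP.+-assoc t 1 below))))
    cancel false {s}     eq = trans (sym (ℕP.+-identityʳ s)) eq

  recolour-pos : ∀ {p a} → ℤ.0ℤ ℤ.< a → toℕ p < toℕ I →
                 T (separatesWithColour y I (p , I , a)) → T (separatesWithColour y J (p , J , a))
  recolour-pos {p} {a} 0<a p<I sep = subst T (sym (separatesWithColour-pos y J p<J 0<a))
    (Equivalence.from T-∧ (does-complete (intℚ a ℚP.<? y p ℚ.- y J) a<ypJ , does-complete (J ≟ J) refl))
    where
    p<J = ℕP.<-trans p<I I<J
    a<ypI : intℚ a ℚ.< y p ℚ.- y I
    a<ypI = does-sound (intℚ a ℚP.<? y p ℚ.- y I)
      (proj₁ (Equivalence.to T-∧ (subst T (separatesWithColour-pos y I p<I 0<a) sep)))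
    a<ypJ = ℚP.<-trans a<ypI (ℚP.+-monoʳ-< (y p) (ℚP.neg-antimono-< yJ<yI))

  recolour-nonpos : ∀ {q a} → ¬ ℤ.0ℤ ℤ.< a → toℕ J < toℕ q →
                    T (separatesWithColour y I (I , q , a)) → T (separatesWithColour y J (J , q , a))
  recolour-nonpos {q} {a} 0≮a J<q sep = subst T (sym (separatesWithColour-nonpos y J J<q 0≮a))
    (Equivalence.from T-∧ (not-does-complete (intℚ a ℚP.<? y J ℚ.- y q) a≮yJq , does-complete (J ≟ J) refl))
    where
    I<q = ℕP.<-trans I<J J<q
    a≮yIq : ¬ intℚ a ℚ.< y I ℚ.- y q
    a≮yIq = not-does-sound (intℚ a ℚP.<? y I ℚ.- y q)
      (proj₁ (Equivalence.to T-∧ (subst T (separatesWithColour-nonpos y I I<q 0≮a) sep)))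
    a≮yJq = λ a<yJq → a≮yIq (ℚP.<-trans a<yJq (ℚP.+-monoˡ-< (ℚ.- y q) yJ<yI))

  recolour : ∀ {p q} → toℕ p < toℕ q → ¬ (p ≡ I × q ≡ J) → ∀ a →
             T (separatesWithColour y I (p , q , a)) → T (separatesWithColour y J (τ p , τ q , a))
  recolour {p} {q} p<q ≢IJ a sep = by-sign (ℤ.0ℤ ℤP.<? a)
    where
    coloured-I : colour (p , q , a) ≡ I
    coloured-I = separatesWithColour⇒colour y I (p , q , a) sep

    by-sign : Dec (ℤ.0ℤ ℤ.< a) → T (separatesWithColour y J (τ p , τ q , a))
    by-sign (yes 0<a) = subst₂ (λ u v → T (separatesWithColour y J (u , v , a))) (sym τp≡p) (sym τq≡J)
        (recolour-pos 0<a p<I (subst (λ v → T (separatesWithColour y I (p , v , a))) q≡I sep))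
      where
      q≡I = trans (sym (colour-pos 0<a)) coloured-I
      p<I = subst (λ v → toℕ p < toℕ v) q≡I p<q
      τp≡p = τ-other (λ p≡I → ℕP.<-irrefl (cong toℕ p≡I) p<I)
                     (λ p≡J → ℕP.<-asym I<J (subst (λ u → toℕ u < toℕ I) p≡J p<I))
      τq≡J = trans (cong τ q≡I) τ-I
    by-sign (no 0≮a) = subst₂ (λ u v → T (separatesWithColour y J (u , v , a))) (sym τp≡J) (sym τq≡q)
        (recolour-nonpos 0≮a J<q (subst (λ u → T (separatesWithColour y I (u , q , a))) p≡I sep))
      where
      p≡I = trans (sym (colour-nonpos 0≮a)) coloured-I
      I<q = subst (λ u → toℕ u < toℕ q) p≡I p<q
      q≢J = λ q≡J → ≢IJ (p≡I , q≡J)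
      J<q = ℕP.≤∧≢⇒< (subst (λ t → suc t ≤ toℕ q) (FinP.toℕ-inject₁ i) I<q) (q≢J ∘ FinP.toℕ-injective ∘ sym)
      τp≡J = trans (cong τ p≡I) τ-I
      τq≡q = τ-other (λ q≡I → ℕP.<-irrefl (cong toℕ (sym q≡I)) I<q) q≢J

  label-I≤label-J : label m y I ≤ label m y J
  label-I≤label-J = s≤s (begin
    separatingCount m y I
      ≡⟨ count-catalan (separatesWithColour y I) m ⟩
    sum₂ (pairCount (separatesWithColour y I) m)
      ≤⟨ sum₂-mono recolour-pairs ⟩
    sum₂ (λ p q → pairCount (separatesWithColour y J) m (τ p) (τ q))
      ≡⟨ sum₂-permute (pairCount (separatesWithColour y J) m) (adjT i) ⟨
    sum₂ (pairCount (separatesWithColour y J) m)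
      ≡⟨ count-catalan (separatesWithColour y J) m ⟨
    separatingCount m y J ∎)
    where
    open ℕP.≤-Reasoning
    recolour-pairs : ∀ p q → pairCount (separatesWithColour y I) m p q
                           ≤ pairCount (separatesWithColour y J) m (τ p) (τ q)
    recolour-pairs p q with toℕ p ℕ.<? toℕ q | (p ≟ I) ×-dec (q ≟ J)
    ... | no p≮q | _ = ℕP.≤-trans (ℕP.≤-reflexive (pairCount-≮ (separatesWithColour y I) m p≮q)) z≤n
    ... | yes _  | yes (refl , refl) = ℕP.≤-trans (ℕP.≤-reflexive
      (trans (pairCount-y-IJ I) (cong (if_then below else 0) (dec-false (J ≟ I) (I≢J ∘ sym))))) z≤n
    ... | yes p<q | no ≢IJ = subst₂ _≤_ (sym (pairCount-< (separatesWithColour y I) m p<q))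
                               (sym (pairCount-< (separatesWithColour y J) m (τ-preserves-< ≢IJ p<q)))
      (count-mono (recolour p<q ≢IJ) (shifts m))

SwapRule : ∀ {n} → ℕ → Fin n → Point (suc n) → Point (suc n) → Set
SwapRule m i y z = (label m y I ≤ label m y J → ∀ k → label m z k ≡ label m y (τ k) + δ I k)
                 × (label m y J < label m y I → ∀ k → label m z k + δ J k ≡ label m y (τ k))
  where open AdjacentTransposition i

module _ {n m : ℕ} (i : Fin n) {y z : Point (suc n)} (z≗y∘τ : ∀ k → z k ≡ y (adjT i ⟨$⟩ʳ k)) where

  open AdjacentTransposition i

  swapRule-descent : y J ℚ.< y I → (∀ c → c ≤ m → y I ℚ.- y J ≢ intℚ (ℤ.+ c)) → SwapRule m i y z
  swapRule-descent yJ<yI avoids =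
    (λ _ → label-transpose) , (λ yJ<yI → ⊥-elim (ℕP.<⇒≱ yJ<yI label-I≤label-J))
    where open SwapAtDescent {m = m} i {y} {z} z≗y∘τ yJ<yI avoids

  swapRule-ascent : y I ℚ.< y J → (∀ c → c ≤ m → y J ℚ.- y I ≢ intℚ (ℤ.+ c)) → SwapRule m i y z
  swapRule-ascent yI<yJ avoids = (λ yI≤yJ → ⊥-elim (labels-cross yI≤yJ)) , (λ _ → label-z)
    where
    y≗z∘τ : ∀ k → y k ≡ z (τ k)
    y≗z∘τ k = trans (cong y (sym (τ-involutive k))) (sym (z≗y∘τ (τ k)))

    zI≡yJ : z I ≡ y J
    zI≡yJ = trans (z≗y∘τ I) (cong y τ-I)

    zJ≡yI : z J ≡ y I
    zJ≡yI = trans (z≗y∘τ J) (cong y τ-J)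

    open SwapAtDescent {m = m} i {z} {y} y≗z∘τ (subst₂ ℚ._<_ (sym zJ≡yI) (sym zI≡yJ) yI<yJ)
      (λ c c≤m → avoids c c≤m ∘ trans (cong₂ ℚ._-_ (sym zI≡yJ) (sym zJ≡yI)))

    label-z : ∀ k → label m z k + δ J k ≡ label m y (τ k)
    label-z k = sym (trans (label-transpose (τ k)) (cong₂ _+_ (cong (label m z) (τ-involutive k)) δI-τk))
      where
      δI-τk : δ I (τ k) ≡ δ J k
      δI-τk = cong (if_then 1 else 0) (trans (cong (λ j → does (j ≟ τ k)) (sym τ-J)) (τ-≟ J k))

    labels-cross : label m y I ≤ label m y J → ⊥
    labels-cross yI≤yJ = ℕP.<-irrefl refl (begin-strict
      label m z J             <⟨ ℕP.m<m+n (label m z J) (s≤s z≤n) ⟩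
      label m z J + 1         ≡⟨ cong₂ _+_ (cong (label m z) τ-I) (cong (if_then 1 else 0) (dec-true (I ≟ I) refl)) ⟨
      label m z (τ I) + δ I I ≡⟨ label-transpose I ⟨
      label m y I             ≤⟨ yI≤yJ ⟩
      label m y J             ≡⟨ label-transpose J ⟩
      label m z (τ J) + δ I J ≡⟨ cong₂ _+_ (cong (label m z) τ-J) (cong (if_then 1 else 0) (dec-false (I ≟ J) I≢J)) ⟩
      label m z I + 0         ≡⟨ ℕP.+-identityʳ (label m z I) ⟩
      label m z I             ≤⟨ label-I≤label-J ⟩
      label m z J             ∎)
      where open ℕP.≤-Reasoning

act-∘ : ∀ {n} (π σ ρ : Permutation′ n) → (∀ k → ρ ⟨$⟩ʳ k ≡ σ ⟨$⟩ʳ (π ⟨$⟩ʳ k)) →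
        ∀ x k → act ρ x k ≡ act σ (act π x) k
act-∘ π σ ρ ρ≡σ∘π x k = cong x (trans (cong (ρ ⟨$⟩ˡ_) (sym ρπ⁻¹σ⁻¹k≡k)) (Perm.inverseˡ ρ))
  where
  ρπ⁻¹σ⁻¹k≡k : ρ ⟨$⟩ʳ (π ⟨$⟩ˡ (σ ⟨$⟩ˡ k)) ≡ k
  ρπ⁻¹σ⁻¹k≡k = trans (ρ≡σ∘π _) (trans (cong (σ ⟨$⟩ʳ_) (Perm.inverseʳ π)) (Perm.inverseʳ σ))

mainTheorem1 : (n' m : ℕ) → 1 ≤ m → (i : Fin n') →
    (π ρ : Permutation′ (suc n')) →
    (∀ k → ρ ⟨$⟩ʳ k ≡ adjT i ⟨$⟩ʳ (π ⟨$⟩ʳ k)) →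
    (x : Point (suc n')) → Generic m x → InFundamental x →
    (label m (act π x) (inject₁ i) ≤ label m (act π x) (Data.Fin.suc i) →
      ∀ k → label m (act ρ x) k ≡ label m (act π x) (adjT i ⟨$⟩ʳ k) + δ (inject₁ i) k)
    ×
    (label m (act π x) (Data.Fin.suc i) < label m (act π x) (inject₁ i) →
      ∀ k → label m (act ρ x) k + δ (Data.Fin.suc i) k ≡ label m (act π x) (adjT i ⟨$⟩ʳ k))
mainTheorem1 n m _ i π ρ ρ≡τ∘π x generic fundamental = by-order (FinP.<-cmp P Q)
  where
  open AdjacentTransposition i

  y z : Point (suc n)
  y = act π x
  z = act ρ x

  z≗y∘τ : ∀ k → z k ≡ y (τ k)
  z≗y∘τ k = trans (act-∘ π (adjT i) ρ ρ≡τ∘π x k) (cong y (τ⁻¹≡τ k))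

  -- y I = x P and y J = x Q definitionally, so `fundamental` compares y I with y J.
  P Q : Fin (suc n)
  P = π ⟨$⟩ˡ I
  Q = π ⟨$⟩ˡ J

  avoids : ∀ {u v} → toℕ u < toℕ v → ∀ c → c ≤ m → x u ℚ.- x v ≢ intℚ (ℤ.+ c)
  avoids = generic⇒avoids {x = x} generic

  by-order : Tri (toℕ P < toℕ Q) (P ≡ Q) (toℕ Q < toℕ P) → SwapRule m i y z
  by-order (tri< P<Q _ _) = swapRule-descent i {y} {z} z≗y∘τ (fundamental P Q P<Q) (avoids P<Q)
  by-order (tri> _ _ Q<P) = swapRule-ascent  i {y} {z} z≗y∘τ (fundamental Q P Q<P) (avoids Q<P)
  by-order (tri≈ _ P≡Q _) =
    ⊥-elim (I≢J (trans (sym (Perm.inverseʳ π)) (trans (cong (π ⟨$⟩ʳ_) P≡Q) (Perm.inverseʳ π))))
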